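{- Let $L$ be a planar triangulation with $n_L\ge 3$ vertices, embedded in the plane, and let $H$ be its planar conjugated triangulation. Every vertex of $H$ of degree $2$ is an external vertex of $H$.
   Context: A planar triangulation is a maximal planar simple graph; fix a plane embedding of $L$, so all faces of $L$ are triangles. The planar conjugated triangulation $H$ of $L$ is the plane graph whose vertices are the midpoints of the edges of $L$, and in which, for every bounded face of $L$, the three midpoints of its three boundary edges are joined pairwise by three segments drawn inside that face; nothing is drawn inside the unbounded face of $L$. A vertex of $H$ is external if it lies on the boundary of the unbounded face of $H$, and inner otherwise. -}

module Defs where

open import Data.Nat using (ℕ; zero; suc; _+_; _≤ᵇ_)
open import Data.Fin using (Fin; toℕ; _≟_)
open import Data.Bool using (Bool; true; false; _∧_; _∨_; not; if_then_else_)
open import Data.List using (List; []; _∷_; allFin; upTo; map)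
open import Data.Nat.ListAction using (sum)
open import Data.Product using (_×_; _,_; ∃)
open import Relation.Nullary using (¬_)
open import Relation.Nullary.Decidable using (⌊_⌋)
open import Relation.Binary.PropositionalEquality using (_≡_; _≢_)

-- Combinatorial maps (rotation systems) as a discrete encoding of a
-- cellularly embedded graph.  Darts are Fin N.
--   α : the edge involution (dart ↦ reversed dart)
--   φ : the face permutation; the face to the LEFT of a dart d is
--       traversed counterclockwise as d, φ d, φ (φ d), …
--       (head of d = tail of φ d)
--   σ = φ ∘ α : rotation around the tail vertex of a dart.
-- Vertices = σ-orbits, edges = α-orbits, faces = φ-orbits.

record CMap : Set where
  field
    N : ℕ
    α : Fin N → Fin N
    φ : Fin N → Fin N

iter : {A : Set} → (A → A) → ℕ → A → A
iter f zero    x = x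
iter f (suc k) x = f (iter f k x)

SameOrbit : {A : Set} → (A → A) → A → A → Set
SameOrbit f x y = ∃ λ k → iter f k x ≡ y

allᵇ : {A : Set} → (A → Bool) → List A → Bool
allᵇ p []       = true
allᵇ p (x ∷ xs) = p x ∧ allᵇ p xs

count : {A : Set} → (A → Bool) → List A → ℕ
count p xs = sum (map (λ x → if p x then 1 else 0) xs)

module _ (M : CMap) where
  open CMap M

  σ : Fin N → Fin N
  σ d = φ (α d)

  -- d is the element of smallest index in its p-orbit
  -- (orbits of a permutation of Fin N have length ≤ N)
  isOrbitRep : (Fin N → Fin N) → Fin N → Bool
  isOrbitRep p d = allᵇ (λ k → toℕ d ≤ᵇ toℕ (iter p k d)) (upTo N)

  numOrbits : (Fin N → Fin N) → ℕ
  numOrbits p = count (isOrbitRep p) (allFin N)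

  numVertices numEdges numFaces : ℕ
  numVertices = numOrbits σ
  numEdges    = numOrbits α
  numFaces    = numOrbits φ

  data Reach (d : Fin N) : Fin N → Set where
    here  : Reach d d
    viaα  : ∀ {e} → Reach d e → Reach d (α e)
    viaφ  : ∀ {e} → Reach d e → Reach d (φ e)

  record IsPlaneTriangulation : Set where
    field
      α-invol      : ∀ d → α (α d) ≡ d
      α-noFix      : ∀ d → α d ≢ d
      φ-injective  : ∀ d e → φ d ≡ φ e → d ≡ e
      φ-triangle   : ∀ d → φ (φ (φ d)) ≡ d
      φ-noFix      : ∀ d → φ d ≢ d
      connected    : ∀ d e → Reach d e
      -- genus 0 (plane embedding): Euler's formula V - E + F = 2
      euler        : numVertices + numFaces ≡ numEdges + 2
      -- simple graph: no loops (tail d ≠ head d = tail (α d))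
      noLoop       : ∀ d → ¬ SameOrbit σ d (α d)
      noMultiEdge  : ∀ d e → SameOrbit σ d e → SameOrbit σ (α d) (α e) → d ≡ e

  -- The conjugated triangulation H, for the embedding whose unbounded
  -- face is the face (φ-orbit) of the dart d₀.
  module Conjugated (d₀ : Fin N) where

    eqᵇ : Fin N → Fin N → Bool
    eqᵇ a b = ⌊ a ≟ b ⌋

    bounded : Fin N → Bool
    bounded d = not (eqᵇ d d₀ ∨ eqᵇ d (φ d₀) ∨ eqᵇ d (φ (φ d₀)))

    -- For each dart c of a bounded face f, H has the segment h_c inside f
    -- joining the midpoint of edge(c) and the midpoint of edge(φ c)
    -- (it cuts off the corner of f at head(c) = tail(φ c)).
    -- H-darts: (c , out) runs mid(edge c) → mid(edge φc);
    --          (c , inn) runs mid(edge φc) → mid(edge c).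
    data Side : Set where
      out inn : Side

    HDart : Set
    HDart = Fin N × Side

    validH : HDart → Bool
    validH (c , _) = bounded c

    -- the L-dart representing the edge of L (= vertex of H) at which an
    -- H-dart starts
    tailH : HDart → Fin N
    tailH (c , out) = c
    tailH (c , inn) = φ c

    atVertex : Fin N → HDart → Bool
    atVertex d x = eqᵇ (tailH x) d ∨ eqᵇ (tailH x) (α d)

    -- Face permutation of the plane graph H (faces on the left,
    -- same convention as φ), derived from the drawing: around the
    -- midpoint m of edge(d) the H-darts in counterclockwise order are
    -- (d,out), (φ²d,inn), (αd,out), (φ²(αd),inn)  (the ones in an
    -- unbounded L-face being absent); φH = (clockwise rotation) ∘ αH.
    φH : HDart → HDart
    φH (c , out) = (φ c , out)
    φH (c , inn) = if bounded (α c) then (φ (φ (α c)) , inn)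
                                    else (φ (φ c) , inn)

    degH : Fin N → ℕ
    degH d = count (λ c → bounded c ∧ atVertex d (c , out)) (allFin N)
           + count (λ c → bounded c ∧ atVertex d (c , inn)) (allFin N)

    -- The unbounded face of H: the φH-orbit of the H-dart (α d₀ , inn),
    -- whose left side is the corner region of the bounded face of α d₀
    -- adjacent to the outer edge edge(d₀), i.e. it borders the unbounded
    -- face of L, across which nothing of H is drawn.
    OnUnboundedFaceH : HDart → Set
    OnUnboundedFaceH x = SameOrbit φH (α d₀ , inn) x

    ExternalH : Fin N → Set
    ExternalH d = ∃ λ x → validH x ≡ true × atVertex d x ≡ true × OnUnboundedFaceH x

-- A vertex of H is the midpoint of an edge e of L.  If both faces of L at e
-- are bounded, two segments of each of them end at e, so the vertex has
-- degree 4.  Both faces cannot be the unbounded one, since a triangle of a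
-- simple graph never uses both sides of an edge.  In the remaining case e is
-- an outer edge, and its midpoint lies on the boundary of the unbounded face
-- of H: that boundary turns around each outer vertex v of L through the
-- corners at v of the bounded faces, passing from the midpoint of one outer
-- edge at v to the midpoint of the next, so it meets all three outer edges.
module Submission where

open import Defs
open import Data.Nat using (ℕ; zero; suc; _≤_; _+_; _∸_; _*_; z≤n; s≤s)
open import Data.Nat.Properties
  using (+-comm; +-suc; *-suc; m+[n∸m]≡n; m≤n+m; ≤-refl; ≤-trans; +-mono-≤; n≮n)
open import Data.Fin using (Fin; toℕ; _≟_)
open import Data.Fin.Properties using (pigeonhole)
open import Data.Bool using (Bool; true; false; _∧_)
open import Data.Bool.Properties using (∨-comm)
open import Data.List using (allFin)
open import Data.List.Membership.Propositional using (_∈_)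
open import Data.List.Membership.Propositional.Properties using (∈-allFin)
open import Data.List.Relation.Unary.Any using (here; there)
open import Data.Product using (_,_; ∃)
open import Data.Sum using (_⊎_; inj₁; inj₂; [_,_])
open import Data.Empty using (⊥-elim)
open import Function using (_∘_)
open import Function.Definitions using (Injective)
open import Relation.Nullary using (¬_; yes; no; contradiction)
open import Relation.Binary.PropositionalEquality hiding ([_])

module _ {A : Set} {f : A → A} where

  iter-+ : ∀ m n x → iter f (m + n) x ≡ iter f m (iter f n x)
  iter-+ zero    n x = refl
  iter-+ (suc m) n x = cong f (iter-+ m n x)

  SameOrbit-trans : ∀ {x y z} → SameOrbit f x y → SameOrbit f y z → SameOrbit f x z
  SameOrbit-trans {x} (k , fᵏx≡y) (m , fᵐy≡z) =
    m + k , trans (iter-+ m k x) (trans (cong (iter f m) fᵏx≡y) fᵐy≡z)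

  iter-* : ∀ p {x} → iter f p x ≡ x → ∀ k → iter f (k * p) x ≡ x
  iter-* p     fᵖx≡x zero    = refl
  iter-* p {x} fᵖx≡x (suc k) =
    trans (iter-+ p (k * p) x) (trans (cong (iter f p) (iter-* p fᵖx≡x k)) fᵖx≡x)

  iter-injective : Injective _≡_ _≡_ f → ∀ n → Injective _≡_ _≡_ (iter f n)
  iter-injective f-inj zero    eq = eq
  iter-injective f-inj (suc n) eq = iter-injective f-inj n (f-inj eq)

module _ {N : ℕ} {f : Fin N → Fin N} (f-inj : Injective _≡_ _≡_ f) where

  iter-periodic : ∀ x → ∃ λ p → iter f (suc p) x ≡ x
  iter-periodic x with pigeonhole (s≤s ≤-refl) (λ i → iter f (toℕ i) x)
  ... | i , j , i<j , fⁱx≡fʲx =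
    p , iter-injective f-inj (toℕ i) (begin
      iter f (toℕ i) (iter f (suc p) x) ≡⟨ iter-+ (toℕ i) (suc p) x ⟨
      iter f (toℕ i + suc p) x          ≡⟨ cong (λ n → iter f n x) (trans (+-suc (toℕ i) p) (m+[n∸m]≡n i<j)) ⟩
      iter f (toℕ j) x                  ≡⟨ fⁱx≡fʲx ⟨
      iter f (toℕ i) x                  ∎)
    where
    open ≡-Reasoning
    p : ℕ
    p = toℕ j ∸ suc (toℕ i)

  -- x returns to itself after k (p + 1) steps, the first k of which lead to y.
  SameOrbit-sym : ∀ {x y} → SameOrbit f x y → SameOrbit f y x
  SameOrbit-sym {x} {y} (k , fᵏx≡y) with iter-periodic x
  ... | p , fᵖ⁺¹x≡x = k * p , (begin
    iter f (k * p) y            ≡⟨ cong (iter f (k * p)) fᵏx≡y ⟨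
    iter f (k * p) (iter f k x) ≡⟨ iter-+ (k * p) k x ⟨
    iter f (k * p + k) x        ≡⟨ cong (λ n → iter f n x) (trans (+-comm (k * p) k) (sym (*-suc k p))) ⟩
    iter f (k * suc p) x        ≡⟨ iter-* (suc p) fᵖ⁺¹x≡x k ⟩
    x                           ∎)
    where open ≡-Reasoning

module _ {A : Set} {p : A → Bool} where

  ∈⇒1≤count : ∀ {x xs} → x ∈ xs → p x ≡ true → 1 ≤ count p xs
  ∈⇒1≤count (here refl) px rewrite px = s≤s z≤n
  ∈⇒1≤count (there x∈xs) px = ≤-trans (∈⇒1≤count x∈xs px) (m≤n+m _ _)

  ∈∈⇒2≤count : ∀ {x y xs} → x ∈ xs → y ∈ xs → x ≢ y →
               p x ≡ true → p y ≡ true → 2 ≤ count p xs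
  ∈∈⇒2≤count (here refl) (here refl)  x≢y px py = ⊥-elim (x≢y refl)
  ∈∈⇒2≤count (here refl) (there y∈xs) x≢y px py rewrite px = s≤s (∈⇒1≤count y∈xs py)
  ∈∈⇒2≤count (there x∈xs) (here refl) x≢y px py rewrite py = s≤s (∈⇒1≤count x∈xs px)
  ∈∈⇒2≤count (there x∈xs) (there y∈xs) x≢y px py =
    ≤-trans (∈∈⇒2≤count x∈xs y∈xs x≢y px py) (m≤n+m _ _)

module Triangle {A : Set} (φ : A → A) (φ³≡id : ∀ x → φ (φ (φ x)) ≡ x) where

  InFace : A → A → Set
  InFace q x = x ≡ q ⊎ x ≡ φ q ⊎ x ≡ φ (φ q)

  InFace-φ : ∀ {q x} → InFace q x → InFace q (φ x)
  InFace-φ (inj₁ refl)        = inj₂ (inj₁ refl)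
  InFace-φ (inj₂ (inj₁ refl)) = inj₂ (inj₂ refl)
  InFace-φ (inj₂ (inj₂ refl)) = inj₁ (φ³≡id _)

  InFace-sym : ∀ {q x} → InFace q x → InFace x q
  InFace-sym (inj₁ refl)        = inj₁ refl
  InFace-sym (inj₂ (inj₁ refl)) = inj₂ (inj₂ (sym (φ³≡id _)))
  InFace-sym (inj₂ (inj₂ refl)) = inj₂ (inj₁ (sym (φ³≡id _)))

  InFace-trans : ∀ {x q y} → InFace x q → InFace q y → InFace x y
  InFace-trans x∼q (inj₁ refl)        = x∼q
  InFace-trans x∼q (inj₂ (inj₁ refl)) = InFace-φ x∼q
  InFace-trans x∼q (inj₂ (inj₂ refl)) = InFace-φ (InFace-φ x∼q)

module PlaneTriangulation (L : CMap) (T : IsPlaneTriangulation L) where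
  open CMap L
  open IsPlaneTriangulation T
  open Triangle φ φ-triangle public

  σ-α : ∀ q → σ L (α q) ≡ φ q
  σ-α q = cong φ (α-invol q)

  σ-injective : Injective _≡_ _≡_ (σ L)
  σ-injective {x} {y} eq =
    trans (sym (α-invol x)) (trans (cong α (φ-injective _ _ eq)) (α-invol y))

  SameTail : Fin N → Fin N → Set
  SameTail = SameOrbit (σ L)

  SameTail-α-φ : ∀ q → SameTail (α q) (φ q)
  SameTail-α-φ q = 1 , σ-α q

  ¬SameTail-φ : ∀ q → ¬ SameTail q (φ q)
  ¬SameTail-φ q q∼φq = noLoop q (SameOrbit-trans q∼φq (SameOrbit-sym σ-injective (SameTail-α-φ q)))

  ¬SameTail-φ² : ∀ q → ¬ SameTail q (φ (φ q))
  ¬SameTail-φ² q q∼φ²q =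
    ¬SameTail-φ (φ (φ q)) (subst (SameTail (φ (φ q))) (sym (φ-triangle q)) (SameOrbit-sym σ-injective q∼φ²q))

  InFace∧SameTail⇒≡ : ∀ {q y} → InFace q y → SameTail q y → y ≡ q
  InFace∧SameTail⇒≡ (inj₁ y≡q)              _     = y≡q
  InFace∧SameTail⇒≡ {q} (inj₂ (inj₁ refl)) q∼y = ⊥-elim (¬SameTail-φ q q∼y)
  InFace∧SameTail⇒≡ {q} (inj₂ (inj₂ refl)) q∼y = ⊥-elim (¬SameTail-φ² q q∼y)

  α≢φ : ∀ p → α p ≢ φ p
  α≢φ p αp≡φp = ¬SameTail-φ² p
    (subst (λ u → SameTail u (φ (φ p))) (trans (cong α (sym αp≡φp)) (α-invol p)) (SameTail-α-φ (φ p)))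

  α≢φ² : ∀ p → α p ≢ φ (φ p)
  α≢φ² p αp≡φ²p =
    α≢φ (φ (φ p)) (trans (cong α (sym αp≡φ²p)) (trans (α-invol p) (sym (φ-triangle p))))

  α∉InFace : ∀ d → ¬ InFace d (α d)
  α∉InFace d = [ α-noFix d , [ α≢φ d , α≢φ² d ] ]

  module ConjugatedOf (d₀ : Fin N) where
    open Conjugated L d₀

    Outer : Fin N → Set
    Outer = InFace d₀

    outer⇒bounded≡false : ∀ {y} → Outer y → bounded y ≡ false
    outer⇒bounded≡false {y} o with y ≟ d₀ | y ≟ φ d₀ | y ≟ φ (φ d₀)
    ... | yes _ | _     | _     = refl
    ... | no _  | yes _ | _     = refl
    ... | no _  | no _  | yes _ = refl
    ... | no ¬p | no ¬q | no ¬r = contradiction o [ ¬p , [ ¬q , ¬r ] ]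

    bounded≡false⇒outer : ∀ {y} → bounded y ≡ false → Outer y
    bounded≡false⇒outer {y} b with y ≟ d₀ | y ≟ φ d₀ | y ≟ φ (φ d₀)
    ... | yes p | _     | _     = inj₁ p
    ... | no _  | yes p | _     = inj₂ (inj₁ p)
    ... | no _  | no _  | yes p = inj₂ (inj₂ p)
    ... | no _  | no _  | no _  with () ← b

    bounded-φ : ∀ {x} → bounded x ≡ true → bounded (φ x) ≡ true
    bounded-φ {x} b with bounded (φ x) in bφ
    ... | true  = refl
    ... | false = contradiction
      (trans (sym b) (outer⇒bounded≡false (InFace-trans (bounded≡false⇒outer bφ) x∈faceφx)))
      λ ()
      where
      x∈faceφx : InFace (φ x) x
      x∈faceφx = inj₂ (inj₂ (sym (φ-triangle x)))

    -- The segment of H that starts at the midpoint of edge t and cuts off the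
    -- corner at tail t of the face of t.
    cornerH : Fin N → HDart
    cornerH t = φ (φ t) , inn

    atVertex-tailH : ∀ x → atVertex (tailH x) x ≡ true
    atVertex-tailH x with tailH x ≟ tailH x
    ... | yes _  = refl
    ... | no ¬eq = contradiction refl ¬eq

    atVertex-α : ∀ d x → atVertex (α d) x ≡ atVertex d x
    atVertex-α d x rewrite α-invol d = ∨-comm (eqᵇ (tailH x) (α d)) (eqᵇ (tailH x) d)

    atVertex-cornerH : ∀ t → atVertex t (cornerH t) ≡ true
    atVertex-cornerH t rewrite φ-triangle t = atVertex-tailH (t , out)

    3≤degH : ∀ {d} → bounded d ≡ true → bounded (α d) ≡ true → 3 ≤ degH d
    3≤degH {d} b bα = +-mono-≤ starting-out starting-in
      where
      starting-out : 2 ≤ count (λ c → bounded c ∧ atVertex d (c , out)) (allFin N)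
      starting-out = ∈∈⇒2≤count (∈-allFin d) (∈-allFin (α d)) (α-noFix d ∘ sym)
        (cong₂ _∧_ b (atVertex-tailH (d , out)))
        (cong₂ _∧_ bα (trans (sym (atVertex-α d (α d , out))) (atVertex-tailH (α d , out))))
      starting-in : 1 ≤ count (λ c → bounded c ∧ atVertex d (c , inn)) (allFin N)
      starting-in = ∈⇒1≤count (∈-allFin (φ (φ d)))
        (cong₂ _∧_ (bounded-φ (bounded-φ b)) (atVertex-cornerH d))

    φH-cornerH-σ-bounded : ∀ y → bounded y ≡ true → φH (cornerH (σ L y)) ≡ cornerH y
    φH-cornerH-σ-bounded y b rewrite φ-triangle (α y) | α-invol y | b = refl

    φH-cornerH-σ-outer : ∀ y → bounded y ≡ false → φH (cornerH (σ L y)) ≡ cornerH (α y)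
    φH-cornerH-σ-outer y b rewrite φ-triangle (α y) | α-invol y | b = refl

    -- φH turns round tail q against σ through the corners of the bounded
    -- faces, until the next dart is the outer dart q itself; then it leaves
    -- along the edge of q.
    around-outer-vertex : ∀ {q} → Outer q → ∀ j →
                          SameOrbit φH (cornerH (iter (σ L) (suc j) q)) (cornerH (α q))
    around-outer-vertex {q} oq zero = 1 , φH-cornerH-σ-outer q (outer⇒bounded≡false oq)
    around-outer-vertex {q} oq (suc j) with bounded (iter (σ L) (suc j) q) in b
    ... | true  = SameOrbit-trans (1 , φH-cornerH-σ-bounded _ b) (around-outer-vertex oq j)
    ... | false = 1 , trans (φH-cornerH-σ-outer _ b) (cong (cornerH ∘ α) y≡q)
      where
      y≡q : iter (σ L) (suc j) q ≡ q
      y≡q = InFace∧SameTail⇒≡ (InFace-trans (InFace-sym oq) (bounded≡false⇒outer b)) (suc j , refl)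

    along-outer-edge : ∀ {p} → Outer (φ p) → SameOrbit φH (cornerH (α p)) (cornerH (α (φ p)))
    along-outer-edge {p} oφp with SameOrbit-sym σ-injective (SameTail-α-φ p)
    ... | zero  , φp≡αp = ⊥-elim (α≢φ p (sym φp≡αp))
    ... | suc j , σʲ⁺¹φp≡αp =
      subst (λ u → SameOrbit φH (cornerH u) (cornerH (α (φ p)))) σʲ⁺¹φp≡αp (around-outer-vertex oφp j)

    cornerH-αd₀-on-unbounded-face : OnUnboundedFaceH (cornerH (α d₀))
    cornerH-αd₀-on-unbounded-face = 1 , enter
      where
      enter : φH (α d₀ , inn) ≡ cornerH (α d₀)
      enter rewrite α-invol d₀ | outer⇒bounded≡false {d₀} (inj₁ refl) = refl

    cornerH-αφd₀-on-unbounded-face : OnUnboundedFaceH (cornerH (α (φ d₀)))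
    cornerH-αφd₀-on-unbounded-face =
      SameOrbit-trans cornerH-αd₀-on-unbounded-face (along-outer-edge (inj₂ (inj₁ refl)))

    cornerH-α-outer-on-unbounded-face : ∀ {q} → Outer q → OnUnboundedFaceH (cornerH (α q))
    cornerH-α-outer-on-unbounded-face (inj₁ refl)        = cornerH-αd₀-on-unbounded-face
    cornerH-α-outer-on-unbounded-face (inj₂ (inj₁ refl)) = cornerH-αφd₀-on-unbounded-face
    cornerH-α-outer-on-unbounded-face (inj₂ (inj₂ refl)) =
      SameOrbit-trans cornerH-αφd₀-on-unbounded-face (along-outer-edge (inj₂ (inj₂ refl)))

    cornerH-external : ∀ {t} → bounded t ≡ true → OnUnboundedFaceH (cornerH t) → ExternalH t
    cornerH-external {t} b onBoundary =
      cornerH t , bounded-φ (bounded-φ b) , atVertex-cornerH t , onBoundary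

    ExternalH-α : ∀ {d} → ExternalH (α d) → ExternalH d
    ExternalH-α {d} (x , valid , at , onBoundary) =
      x , valid , trans (sym (atVertex-α d x)) at , onBoundary

    degH≡2⇒ExternalH : ∀ d → degH d ≡ 2 → ExternalH d
    degH≡2⇒ExternalH d deg with bounded d in b | bounded (α d) in bα
    ... | true  | true  = contradiction (subst (3 ≤_) deg (3≤degH b bα)) (n≮n 2)
    ... | false | false = ⊥-elim (α∉InFace d
      (InFace-trans (InFace-sym (bounded≡false⇒outer b)) (bounded≡false⇒outer bα)))
    ... | false | true  = ExternalH-α (cornerH-external bα
      (cornerH-α-outer-on-unbounded-face (bounded≡false⇒outer b)))
    ... | true  | false = cornerH-external b
      (subst (OnUnboundedFaceH ∘ cornerH) (α-invol d)
        (cornerH-α-outer-on-unbounded-face (bounded≡false⇒outer bα)))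

theorem13 : (L : CMap) → IsPlaneTriangulation L → 3 ≤ numVertices L
          → (d₀ : Fin (CMap.N L))
          → (d : Fin (CMap.N L))
          → Conjugated.degH L d₀ d ≡ 2
          → Conjugated.ExternalH L d₀ d
theorem13 L T _ d₀ = PlaneTriangulation.ConjugatedOf.degH≡2⇒ExternalH L T d₀
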